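{- Let $m\ge 2$ and let $G_1,G_2$ be vertex-disjoint, nontrivial (i.e. having more than one vertex), connected $m$-uniform hypergraphs. Let $u_1\in V(G_1)$, $u_2\in V(G_2)$, and let $G=G_1(u)\odot G_2(u)$ be the coalescence obtained by identifying $u_1$ and $u_2$ into a new vertex $u$. Then $s(G)=s(G_1)\cdot s(G_2)$.
   Context: An $m$-uniform hypergraph $G=(V,E)$ has a finite vertex set $V=\{v_1,\dots,v_n\}$ and an edge set $E$ consisting of $m$-element subsets of $V$. A walk is a sequence $v_0e_1v_1\dots e_tv_t$ with $v_{i-1}\ne v_i$ and $\{v_{i-1},v_i\}\subseteq e_i$; $G$ is connected if any two vertices are joined by a walk. The adjacency tensor $\mathcal{A}(G)=(a_{i_1\dots i_m})$ is the order-$m$, dimension-$n$ tensor with $a_{i_1\dots i_m}=\frac{1}{(m-1)!}$ if $\{v_{i_1},\dots,v_{i_m}\}\in E$ and $0$ otherwise. For an order-$m$, dimension-$n$ tensor $\mathcal{A}$, the stabilizing index $s(\mathcal{A})$ is the cardinality of the set of invertible complex diagonal matrices $D=\mathrm{diag}(d_1,\dots,d_n)$ with $d_1=1$ such that $d_{i_1}^{ -(m-1)}a_{i_1\dots i_m}d_{i_2}\cdots d_{i_m}=a_{i_1\dots i_m}$ for all $i_1,\dots,i_m\in[n]$ (this set is a finite group). The stabilizing index of $G$ is $s(G):=s(\mathcal{A}(G))$; for connected $G$ it equals the number of eigenvectors (up to scalar multiples) of $\mathcal{A}(G)$ associated with its spectral radius. -}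

module Defs where

open import Level using (Level; _⊔_) renaming (suc to lsuc)
open import Algebra.Bundles using (CommutativeRing)
open import Data.Nat using (ℕ; zero; suc; _∸_; _!; NonZero)
open import Data.Nat.Properties using (_!≢0)
open import Data.Bool using (Bool; true; false; if_then_else_)
import Data.Bool.Properties as BoolP
open import Data.Fin using (Fin; zero; suc; toℕ)
import Data.Fin.Properties as FinP
open import Data.Fin.Subset using (Subset; ∣_∣) renaming (_∈_ to _∈ₛ_)
open import Data.Vec using (tabulate; lookup)
open import Data.Vec.Properties using (≡-dec)
open import Data.List using (List)
open import Data.List.Relation.Unary.All using (All)
open import Data.List.Membership.Propositional using (_∈_)
import Data.List.Relation.Unary.Any as Any
open import Data.Product using (Σ; ∃; ∃-syntax; _×_; _,_)
open import Relation.Nullary using (¬_; does)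
open import Relation.Nullary.Decidable using (_×-dec_; _⊎-dec_)
open import Data.Sum using (_⊎_)
open import Relation.Binary.PropositionalEquality using (_≡_; _≢_)
open import Function.Bundles using (_⇔_)

-- m-uniform hypergraphs on the vertex set Fin n  (v_1,…,v_n ↦ 0,…,n-1)

record Hypergraph (m n : ℕ) : Set where
  field
    edges   : List (Subset n)
    uniform : All (λ e → ∣ e ∣ ≡ m) edges

open Hypergraph public

data Walk {m n : ℕ} (G : Hypergraph m n) : Fin n → Fin n → Set where
  here : ∀ {x} → Walk G x x
  step : ∀ {x y z} (e : Subset n) → e ∈ edges G → x ≢ y →
         x ∈ₛ e → y ∈ₛ e → Walk G y z → Walk G x z

Connected : ∀ {m n} → Hypergraph m n → Set
Connected {n = n} G = (x y : Fin n) → Walk G x y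

mapS : ∀ {a b} → (Fin a → Fin b) → Subset a → Subset b
mapS f s = tabulate λ v → does (FinP.any? λ w → BoolP._≟_ (lookup s w) true ×-dec FinP._≟_ (f w) v)

Injective : ∀ {a b} → (Fin a → Fin b) → Set
Injective f = ∀ x y → f x ≡ f y → x ≡ y

-- G (on Fin n) is the coalescence G₁(u) ⊙ G₂(u) of the vertex-disjoint
-- hypergraphs G₁, G₂, identifying u₁ and u₂; f₁, f₂ are the embeddings
-- of the vertex sets of G₁ and G₂ into the vertex set of G.
record IsCoalescence {m n₁ n₂ n : ℕ}
    (G₁ : Hypergraph m n₁) (u₁ : Fin n₁) (G₂ : Hypergraph m n₂) (u₂ : Fin n₂)
    (G : Hypergraph m n) (f₁ : Fin n₁ → Fin n) (f₂ : Fin n₂ → Fin n) : Set where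
  field
    inj₁    : Injective f₁
    inj₂    : Injective f₂
    glue    : f₁ u₁ ≡ f₂ u₂
    onlyU   : ∀ a b → f₁ a ≡ f₂ b → (a ≡ u₁) × (b ≡ u₂)
    cover   : ∀ v → (∃[ a ] f₁ a ≡ v) ⊎ (∃[ b ] f₂ b ≡ v)
    edgesEq : ∀ e → (e ∈ edges G) ⇔
                ((∃[ e₁ ] (e₁ ∈ edges G₁ × e ≡ mapS f₁ e₁)) ⊎
                 (∃[ e₂ ] (e₂ ∈ edges G₂ × e ≡ mapS f₂ e₂)))

-- Scalars: a field of characteristic 0 (stand-in for ℂ)

module _ {c ℓ} (R : CommutativeRing c ℓ) where
  open CommutativeRing R using (Carrier; 0#; 1#; _+_; _*_)

  natK : ℕ → Carrier
  natK zero    = 0#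
  natK (suc k) = 1# + natK k

  powK : Carrier → ℕ → Carrier
  powK x zero    = 1#
  powK x (suc k) = x * powK x k

  prodK : ∀ {k} → (Fin k → Carrier) → Carrier
  prodK {zero}  f = 1#
  prodK {suc k} f = f zero * prodK (λ i → f (suc i))

record CharZeroField c ℓ : Set (lsuc (c ⊔ ℓ)) where
  field
    ring : CommutativeRing c ℓ
  open CommutativeRing ring using (Carrier; 0#; 1#; _*_; _≈_)
  field
    inv      : (x : Carrier) → ¬ (x ≈ 0#) → Carrier
    inv-r    : ∀ x (p : ¬ (x ≈ 0#)) → x * inv x p ≈ 1#
    charZero : ∀ k → ¬ (natK ring (suc k) ≈ 0#)

module _ {c ℓ} (K : CharZeroField c ℓ) where
  open CharZeroField K
  open CommutativeRing ring using (Carrier; 0#; 1#; _*_; _≈_)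

  natK-nz : ∀ n → .{{_ : NonZero n}} → ¬ (natK ring n ≈ 0#)
  natK-nz (suc k) = charZero k

  weight : ℕ → Carrier
  weight m = inv (natK ring ((m ∸ 1) !)) (natK-nz ((m ∸ 1) !) {{(m ∸ 1) !≢0}})

  -- index tuple (i₁,…,i_m) written as i₁ together with (i₂,…,i_m) : Fin (m-1) → Fin n
  tupleSet : ∀ {m n} → Fin n → (Fin (m ∸ 1) → Fin n) → Subset n
  tupleSet i js = tabulate λ v → does (FinP._≟_ i v ⊎-dec FinP.any? λ k → FinP._≟_ (js k) v)

  adjT : ∀ {m n} → Hypergraph m n → Fin n → (Fin (m ∸ 1) → Fin n) → Carrier
  adjT {m} G i js = if does (Any.any? (λ e → ≡-dec BoolP._≟_ (tupleSet {m} i js) e) (edges G)) then weight m else 0#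

  -- invertible diagonal matrices D = diag(d) (e = entrywise inverse) with d_1 = 1
  -- stabilising 𝒜(G)
  record Stab {m n : ℕ} (G : Hypergraph m n) : Set (c ⊔ ℓ) where
    field
      d    : Fin n → Carrier
      e    : Fin n → Carrier
      d-inv : ∀ i → d i * e i ≈ 1#
      d₁   : ∀ (i : Fin n) → toℕ i ≡ 0 → d i ≈ 1#
      stab : ∀ (i : Fin n) (js : Fin (m ∸ 1) → Fin n) →
             powK ring (e i) (m ∸ 1) * adjT G i js * prodK ring (λ k → d (js k))
               ≈ adjT G i js

  _≈D_ : ∀ {m n} {G : Hypergraph m n} → Stab G → Stab G → Set ℓ
  _≈D_ {n = n} x y = ∀ (i : Fin n) → Stab.d x i ≈ Stab.d y i

  -- s(G) = k : the set of such D has exactly k elements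
  StabIndex : ∀ {m n} → Hypergraph m n → ℕ → Set (c ⊔ ℓ)
  StabIndex G k =
    Σ (Fin k → Stab G) λ f →
      (∀ a b → f a ≈D f b → a ≡ b) × (∀ x → ∃[ a ] (f a ≈D x))

-- A diagonal matrix diag(d) with inverse diag(e) stabilises 𝒜(H) iff e_{i₁}^{m-1} d_{i₂}⋯d_{i_m} = 1 for
-- every edge {i₁,…,i_m}. These conditions are invariant under scaling d by a unit, so s(H) counts their
-- solutions up to proportionality, each class represented by its solution with d = 1 at the first vertex.
-- Every edge of the coalescence G lies in G₁ or in G₂, so the solutions for G with d = 1 at the coalesced
-- vertex u are exactly the pairs of solutions for G₁ and G₂ with d = 1 at u₁ and u₂; rescaling to the
-- first vertex turns this into a bijection between Stab G₁ × Stab G₂ and Stab G.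

module Submission where

open import Defs
open import Level using (_⊔_)
open import Algebra.Bundles using (CommutativeRing)
import Algebra.Properties.CommutativeSemigroup as CommSemigroupProperties
open import Data.Bool using (true)
open import Data.Bool.Properties using (T-≡; ⇔→≡)
import Data.Bool.Properties as Bool
open import Data.Empty using (⊥-elim)
open import Data.Fin using (Fin; zero; suc; remQuot; combine)
open import Data.Fin.Properties using (remQuot-combine; combine-remQuot)
import Data.Fin.Properties as Fin
open import Data.List.Membership.Propositional using (_∈_)
import Data.List.Relation.Unary.Any as Any
open import Data.Nat using (ℕ; zero; suc; _≤_; _*_; _∸_; _!)
open import Data.Product using (Σ; ∃₂; ∃-syntax; _×_; _,_; proj₁; proj₂; uncurry; map)
open import Data.Product.Relation.Binary.Pointwise.NonDependent using (_×ₛ_)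
open import Data.Sum using (_⊎_; inj₁; inj₂; [_,_]′)
open import Data.Vec using (tabulate; lookup)
open import Data.Vec.Properties using (lookup∘tabulate; ≡-dec)
open import Data.Vec.Relation.Binary.Pointwise.Extensional using (ext; Pointwise-≡⇒≡)
import Data.Vec.Functional.Relation.Binary.Equality.Setoid as VectorEquality
open import Function using (_∘_)
open import Function.Bundles using (Bijection; _⇔_; mk⇔; Equivalence)
import Function.Consequences.Setoid as FunctionConsequences
open import Function.Construct.Composition using (_⇔-∘_)
open import Function.Construct.Symmetry using (⇔-sym)
open import Relation.Binary.Bundles using (Setoid)
import Relation.Binary.Construct.On as On
open import Relation.Binary.PropositionalEquality using (_≡_)
import Relation.Binary.PropositionalEquality as ≡
open import Relation.Nullary using (Dec; does; yes; no)
open import Relation.Nullary.Decidable using (toWitness; isYes≗does; dec-true; _×-dec_; _⊎-dec_)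

Enumeration : ∀ {a ℓ} → Setoid a ℓ → ℕ → Set (a ⊔ ℓ)
Enumeration S k = Σ (Fin k → Carrier) λ f → (∀ i j → f i ≈ f j → i ≡ j) × (∀ x → ∃[ i ] f i ≈ x)
  where open Setoid S

enumeration-× : ∀ {a₁ ℓ₁ a₂ ℓ₂ a ℓ} {A : Setoid a₁ ℓ₁} {B : Setoid a₂ ℓ₂} {C : Setoid a ℓ} {k₁ k₂} →
                Enumeration A k₁ → Enumeration B k₂ → Bijection (A ×ₛ B) C → Enumeration C (k₁ * k₂)
enumeration-× {C = C} {k₁} {k₂} (f₁ , f₁-injective , f₁-surjective) (f₂ , f₂-injective , f₂-surjective) φ =
  f , f-injective , f-surjective
  where
  open Bijection φ
  open Setoid C using (Carrier; _≈_) renaming (reflexive to ≈-reflexive; trans to ≈-trans)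

  f : Fin (k₁ * k₂) → Carrier
  f t = to (map f₁ f₂ (remQuot k₂ t))

  f-combine : ∀ i j → f (combine i j) ≡ to (f₁ i , f₂ j)
  f-combine i j = ≡.cong (to ∘ map f₁ f₂) (remQuot-combine i j)

  f-injective : ∀ t t′ → f t ≈ f t′ → t ≡ t′
  f-injective t t′ ft≈ft′ = begin
    t                                     ≡⟨ combine-remQuot {k₁} k₂ t ⟨
    uncurry combine (remQuot {k₁} k₂ t)   ≡⟨ ≡.cong₂ combine (f₁-injective _ _ i≈i′) (f₂-injective _ _ j≈j′) ⟩
    uncurry combine (remQuot {k₁} k₂ t′)  ≡⟨ combine-remQuot {k₁} k₂ t′ ⟩
    t′                                    ∎
    where
    open ≡.≡-Reasoning
    i≈i′ = proj₁ (injective ft≈ft′)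
    j≈j′ = proj₂ (injective ft≈ft′)

  f-surjective : ∀ z → ∃[ t ] f t ≈ z
  f-surjective z =
    let (a , b) , ab≈z = strictlySurjective z
        i , fi≈a = f₁-surjective a
        j , fj≈b = f₂-surjective b
    in combine i j , ≈-trans (≈-reflexive (f-combine i j)) (≈-trans (cong (fi≈a , fj≈b)) ab≈z)

module Proportionality {c ℓ} (R : CommutativeRing c ℓ) where
  open CommutativeRing R
    using (Carrier; _≈_; 1#; refl; sym; trans; setoid; *-cong; *-congˡ; *-congʳ; *-assoc; *-comm;
           *-identityˡ; *-identityʳ; *-commutativeSemigroup)
    renaming (_*_ to _·_)
  open CommSemigroupProperties *-commutativeSemigroup using (interchange)
  open import Relation.Binary.Reasoning.Setoid setoid

  *-inverse : ∀ {x x′ y y′} → x · x′ ≈ 1# → y · y′ ≈ 1# → (x · y) · (x′ · y′) ≈ 1#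
  *-inverse {x} {x′} {y} {y′} xx′ yy′ = begin
    (x · y) · (x′ · y′)  ≈⟨ interchange x y x′ y′ ⟩
    (x · x′) · (y · y′)  ≈⟨ *-cong xx′ yy′ ⟩
    1# · 1#              ≈⟨ *-identityˡ 1# ⟩
    1#                   ∎

  *-cancelʳ : ∀ {a a′ x y} → a · a′ ≈ 1# → x · a ≈ y · a → x ≈ y
  *-cancelʳ {a} {a′} {x} {y} aa′ xa≈ya = begin
    x               ≈⟨ *-identityʳ x ⟨
    x · 1#          ≈⟨ *-congˡ aa′ ⟨
    x · (a · a′)    ≈⟨ *-assoc x a a′ ⟨
    (x · a) · a′    ≈⟨ *-congʳ xa≈ya ⟩
    (y · a) · a′    ≈⟨ *-assoc y a a′ ⟩
    y · (a · a′)    ≈⟨ *-congˡ aa′ ⟩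
    y · 1#          ≈⟨ *-identityʳ y ⟩
    y               ∎

  powK-congˡ : ∀ {x y} k → x ≈ y → powK R x k ≈ powK R y k
  powK-congˡ zero    x≈y = refl
  powK-congˡ (suc k) x≈y = *-cong x≈y (powK-congˡ k x≈y)

  powK-distrib-* : ∀ x y k → powK R (x · y) k ≈ powK R x k · powK R y k
  powK-distrib-* x y zero    = sym (*-identityˡ 1#)
  powK-distrib-* x y (suc k) = trans (*-congˡ (powK-distrib-* x y k)) (interchange x y _ _)

  powK-1# : ∀ k → powK R 1# k ≈ 1#
  powK-1# zero    = refl
  powK-1# (suc k) = trans (*-identityˡ _) (powK-1# k)

  prodK-cong : ∀ {k} {f g : Fin k → Carrier} → (∀ i → f i ≈ g i) → prodK R f ≈ prodK R g
  prodK-cong {zero}  f≈g = refl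
  prodK-cong {suc k} f≈g = *-cong (f≈g zero) (prodK-cong (f≈g ∘ suc))

  prodK-*ʳ : ∀ {k} (f : Fin k → Carrier) x → prodK R (λ i → f i · x) ≈ prodK R f · powK R x k
  prodK-*ʳ {zero}  f x = sym (*-identityˡ 1#)
  prodK-*ʳ {suc k} f x = trans (*-congˡ (prodK-*ʳ (f ∘ suc) x)) (interchange (f zero) x _ _)

  powK-prodK-scale : ∀ {k} {a a′} → a · a′ ≈ 1# → ∀ x (y : Fin k → Carrier) →
                     powK R (x · a′) k · prodK R (λ i → y i · a) ≈ powK R x k · prodK R y
  powK-prodK-scale {k} {a} {a′} aa′ x y = begin
    powK R (x · a′) k · prodK R (λ i → y i · a)
      ≈⟨ *-cong (powK-distrib-* x a′ k) (prodK-*ʳ y a) ⟩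
    (powK R x k · powK R a′ k) · (prodK R y · powK R a k)
      ≈⟨ interchange _ _ _ _ ⟩
    (powK R x k · prodK R y) · (powK R a′ k · powK R a k)
      ≈⟨ *-congˡ (sym (powK-distrib-* a′ a k)) ⟩
    (powK R x k · prodK R y) · powK R (a′ · a) k
      ≈⟨ *-congˡ (powK-congˡ k (trans (*-comm a′ a) aa′)) ⟩
    (powK R x k · prodK R y) · powK R 1# k
      ≈⟨ *-congˡ (powK-1# k) ⟩
    (powK R x k · prodK R y) · 1#
      ≈⟨ *-identityʳ _ ⟩
    powK R x k · prodK R y
      ∎

  infix 4 _∝_

  _∝_ : {I : Set} → (I → Carrier) → (I → Carrier) → Set (c ⊔ ℓ)
  f ∝ g = ∃₂ λ a a′ → a · a′ ≈ 1# × (∀ i → f i ≈ g i · a)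

  ≈⇒∝ : {I : Set} {f g : I → Carrier} → (∀ i → f i ≈ g i) → f ∝ g
  ≈⇒∝ f≈g = 1# , 1# , *-identityˡ 1# , λ i → trans (f≈g i) (sym (*-identityʳ _))

  ∝-sym : {I : Set} {f g : I → Carrier} → f ∝ g → g ∝ f
  ∝-sym {f = f} {g} (a , a′ , aa′ , f≈ga) = a′ , a , trans (*-comm a′ a) aa′ , λ i → begin
    g i               ≈⟨ *-identityʳ (g i) ⟨
    g i · 1#          ≈⟨ *-congˡ aa′ ⟨
    g i · (a · a′)    ≈⟨ *-assoc (g i) a a′ ⟨
    (g i · a) · a′    ≈⟨ *-congʳ (f≈ga i) ⟨
    f i · a′          ∎

  ∝-∘ : {I J : Set} {f g : I → Carrier} (h : J → I) → f ∝ g → (f ∘ h) ∝ (g ∘ h)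
  ∝-∘ h (a , a′ , aa′ , f≈ga) = a , a′ , aa′ , f≈ga ∘ h

  ∝-trans : {I : Set} {f g h : I → Carrier} → f ∝ g → g ∝ h → f ∝ h
  ∝-trans {f = f} {g} {h} (a , a′ , aa′ , f≈ga) (b , b′ , bb′ , g≈hb) =
    b · a , b′ · a′ , *-inverse bb′ aa′ , λ i → begin
      f i              ≈⟨ f≈ga i ⟩
      g i · a          ≈⟨ *-congʳ (g≈hb i) ⟩
      (h i · b) · a    ≈⟨ *-assoc (h i) b a ⟩
      h i · (b · a)    ∎

lookup-tabulate-does : ∀ {p n} {P : Fin n → Set p} (P? : ∀ v → Dec (P v)) v →
                       lookup (tabulate (does ∘ P?)) v ≡ true ⇔ P v
lookup-tabulate-does P? v = mk⇔
  (λ eq → toWitness {a? = P? v}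
            (Equivalence.from T-≡ (≡.trans (isYes≗does (P? v)) (≡.trans (≡.sym (lookup∘tabulate _ v)) eq))))
  (λ Pv → ≡.trans (lookup∘tabulate _ v) (dec-true (P? v) Pv))

mapS-member : ∀ {a b} (f : Fin a → Fin b) s v →
              lookup (mapS f s) v ≡ true ⇔ (∃[ w ] (lookup s w ≡ true × f w ≡ v))
mapS-member f s = lookup-tabulate-does λ v → Fin.any? λ w → Bool._≟_ (lookup s w) true ×-dec Fin._≟_ (f w) v

mapS-injective : ∀ {a b} {f : Fin a → Fin b} → Injective f → ∀ {s t} → mapS f s ≡ mapS f t → s ≡ t
mapS-injective {f = f} f-injective {s} {t} fs≡ft =
  Pointwise-≡⇒≡ (ext λ w → ⇔→≡ (mk⇔ (reflect-⊆ {s} {t} fs≡ft w) (reflect-⊆ {t} {s} (≡.sym fs≡ft) w)))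
  where
  reflect-⊆ : ∀ {s t} → mapS f s ≡ mapS f t → ∀ w → lookup s w ≡ true → lookup t w ≡ true
  reflect-⊆ {s} {t} fs≡ft w w∈s =
    let fw∈fs = Equivalence.from (mapS-member f s (f w)) (w , w∈s , ≡.refl)
        w′ , w′∈t , fw′≡fw = Equivalence.to (mapS-member f t (f w))
                               (≡.subst (λ u → lookup u (f w) ≡ true) fs≡ft fw∈fs)
    in ≡.subst (λ u → lookup t u ≡ true) (f-injective w′ w fw′≡fw) w′∈t

module _ {c ℓ} (K : CharZeroField c ℓ) (m : ℕ) where
  open CharZeroField K using (ring; inv-r)
  open CommutativeRing ring
    using (Carrier; _≈_; 0#; 1#; refl; sym; trans; setoid; *-cong; *-congˡ; *-congʳ; *-assoc; *-comm;
           *-identityˡ; *-identityʳ; zeroˡ; zeroʳ)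
    renaming (_*_ to _·_)

  open Proportionality ring
  open CommSemigroupProperties (CommutativeRing.*-commutativeSemigroup ring) using (xy∙z≈xz∙y)
  open import Relation.Binary.Reasoning.Setoid setoid

  tupleSet-member : ∀ {n} (i : Fin n) js v →
                    lookup (tupleSet K {m} i js) v ≡ true ⇔ (i ≡ v ⊎ ∃[ k ] js k ≡ v)
  tupleSet-member i js = lookup-tabulate-does λ v → Fin._≟_ i v ⊎-dec Fin.any? λ k → Fin._≟_ (js k) v

  mapS-tupleSet : ∀ {a b} (f : Fin a → Fin b) {i′ js′ i js} → f i′ ≡ i → (∀ k → f (js′ k) ≡ js k) →
                  mapS f (tupleSet K {m} i′ js′) ≡ tupleSet K {m} i js
  mapS-tupleSet f {i′} {js′} {i} {js} fi′≡i fjs′≡js =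
    Pointwise-≡⇒≡ (ext λ v →
      ⇔→≡ (⇔-sym (tupleSet-member i js v) ⇔-∘
           (mk⇔ (image v) (preimage v) ⇔-∘ mapS-member f (tupleSet K {m} i′ js′) v)))
    where
    image : ∀ v → ∃[ w ] (lookup (tupleSet K {m} i′ js′) w ≡ true × f w ≡ v) → i ≡ v ⊎ ∃[ k ] js k ≡ v
    image v (w , w∈ , fw≡v) with Equivalence.to (tupleSet-member i′ js′ w) w∈
    ... | inj₁ ≡.refl = inj₁ (≡.trans (≡.sym fi′≡i) fw≡v)
    ... | inj₂ (k , ≡.refl) = inj₂ (k , ≡.trans (≡.sym (fjs′≡js k)) fw≡v)
    preimage : ∀ v → i ≡ v ⊎ ∃[ k ] js k ≡ v → ∃[ w ] (lookup (tupleSet K {m} i′ js′) w ≡ true × f w ≡ v)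
    preimage v (inj₁ i≡v) =
      i′ , Equivalence.from (tupleSet-member i′ js′ i′) (inj₁ ≡.refl) , ≡.trans fi′≡i i≡v
    preimage v (inj₂ (k , jsk≡v)) =
      js′ k , Equivalence.from (tupleSet-member i′ js′ (js′ k)) (inj₂ (k , ≡.refl)) ,
      ≡.trans (fjs′≡js k) jsk≡v

  tupleSet-preimage : ∀ {a b} {f : Fin a → Fin b} → Injective f →
                      ∀ {i js s} → tupleSet K {m} i js ≡ mapS f s →
                      ∃₂ λ i′ js′ → f i′ ≡ i × (∀ k → f (js′ k) ≡ js k) × tupleSet K {m} i′ js′ ≡ s
  tupleSet-preimage {f = f} f-injective {i} {js} {s} ts≡fs =
    i′ , js′ , fi′≡i , fjs′≡js , mapS-injective f-injective (≡.trans (mapS-tupleSet f fi′≡i fjs′≡js) ts≡fs)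
    where
    pull : ∀ {v} → i ≡ v ⊎ ∃[ k ] js k ≡ v → ∃[ w ] (lookup s w ≡ true × f w ≡ v)
    pull {v} v∈ = Equivalence.to (mapS-member f s v)
      (≡.subst (λ t → lookup t v ≡ true) ts≡fs (Equivalence.from (tupleSet-member i js v) v∈))
    i′ : Fin _
    i′ = proj₁ (pull (inj₁ ≡.refl))
    js′ : Fin (m ∸ 1) → Fin _
    js′ k = proj₁ (pull (inj₂ (k , ≡.refl)))
    fi′≡i : f i′ ≡ i
    fi′≡i = proj₂ (proj₂ (pull (inj₁ ≡.refl)))
    fjs′≡js : ∀ k → f (js′ k) ≡ js k
    fjs′≡js k = proj₂ (proj₂ (pull (inj₂ (k , ≡.refl))))

  Stabilising : ∀ {n} → Hypergraph m n → (Fin n → Carrier) → (Fin n → Carrier) → Set ℓ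
  Stabilising H d e =
    ∀ i js → tupleSet K {m} i js ∈ edges H → powK ring (e i) (m ∸ 1) · prodK ring (d ∘ js) ≈ 1#

  record Stabiliser {n} (H : Hypergraph m n) : Set (c ⊔ ℓ) where
    field
      d e         : Fin n → Carrier
      d-inv       : ∀ i → d i · e i ≈ 1#
      stabilising : Stabilising H d e

  open Stabiliser

  adjT-edge : ∀ {n} {H : Hypergraph m n} {i js} → tupleSet K {m} i js ∈ edges H → adjT K H i js ≡ weight K m
  adjT-edge {H = H} {i} {js} edge with Any.any? (λ e → ≡-dec Bool._≟_ (tupleSet K {m} i js) e) (edges H)
  ... | yes _    = ≡.refl
  ... | no ¬edge = ⊥-elim (¬edge edge)

  weight-inverse : weight K m · natK ring ((m ∸ 1) !) ≈ 1#
  weight-inverse = trans (*-comm _ _) (inv-r _ _)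

  stab-stabilising : ∀ {n} {H : Hypergraph m n} (X : Stab K H) → Stabilising H (Stab.d X) (Stab.e X)
  stab-stabilising {H = H} X i js edge = *-cancelʳ weight-inverse (begin
    (powK ring (Stab.e X i) (m ∸ 1) · prodK ring (Stab.d X ∘ js)) · weight K m
      ≈⟨ xy∙z≈xz∙y _ _ _ ⟩
    (powK ring (Stab.e X i) (m ∸ 1) · weight K m) · prodK ring (Stab.d X ∘ js)
      ≈⟨ ≡.subst (λ a → powK ring (Stab.e X i) (m ∸ 1) · a · prodK ring (Stab.d X ∘ js) ≈ a)
                 (adjT-edge {H = H} {i} {js} edge) (Stab.stab X i js) ⟩
    weight K m
      ≈⟨ *-identityˡ _ ⟨
    1# · weight K m
      ∎)

  stabilising-stab : ∀ {n} {H : Hypergraph m n} {d e} → Stabilising H d e → ∀ i js →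
                     powK ring (e i) (m ∸ 1) · adjT K H i js · prodK ring (d ∘ js) ≈ adjT K H i js
  stabilising-stab {H = H} stable i js with Any.any? (λ s → ≡-dec Bool._≟_ (tupleSet K {m} i js) s) (edges H)
  ... | yes edge = trans (xy∙z≈xz∙y _ _ _) (trans (*-congʳ (stable i js edge)) (*-identityˡ _))
  ... | no _     = trans (*-congʳ (zeroʳ _)) (zeroˡ _)

  stabiliser : ∀ {n} {H : Hypergraph m n} → Stab K H → Stabiliser H
  stabiliser X = record
    { d = Stab.d X ; e = Stab.e X ; d-inv = Stab.d-inv X ; stabilising = stab-stabilising X }

  scale : ∀ {n} {H : Hypergraph m n} → Stabiliser H → ∀ {a a′} → a · a′ ≈ 1# → Stabiliser H
  scale X {a} {a′} aa′≈1 = record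
    { d           = λ i → d X i · a
    ; e           = λ i → e X i · a′
    ; d-inv       = λ i → *-inverse (d-inv X i) aa′≈1
    ; stabilising = λ i js edge → trans (powK-prodK-scale aa′≈1 (e X i) (d X ∘ js)) (stabilising X i js edge)
    }

  normaliseAt : ∀ {n} {H : Hypergraph m n} → Fin n → Stabiliser H → Stabiliser H
  normaliseAt z X = scale X (trans (*-comm _ _) (d-inv X z))

  normaliseAt-∝ : ∀ {n} {H : Hypergraph m n} z (X : Stabiliser H) → d (normaliseAt z X) ∝ d X
  normaliseAt-∝ z X = e X z , d X z , trans (*-comm _ _) (d-inv X z) , λ _ → refl

  normaliseAt-d : ∀ {n} {H : Hypergraph m n} z (X : Stabiliser H) → d (normaliseAt z X) z ≈ 1#
  normaliseAt-d z X = d-inv X z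

  normaliseAt-e : ∀ {n} {H : Hypergraph m n} z (X : Stabiliser H) → e (normaliseAt z X) z ≈ 1#
  normaliseAt-e z X = trans (*-comm _ _) (d-inv X z)

  -- The vertex argument only witnesses n > 0, i.e. that there is a first vertex to normalise at.
  normalise : ∀ {n} {H : Hypergraph m n} → Fin n → Stabiliser H → Stab K H
  normalise {zero}  ()
  normalise {suc n} {H} _ X = record
    { d     = d X₀
    ; e     = e X₀
    ; d-inv = d-inv X₀
    ; d₁    = λ { zero _ → d-inv X zero ; (suc _) () }
    ; stab  = stabilising-stab {H = H} {d X₀} (stabilising X₀)
    }
    where
    X₀ : Stabiliser H
    X₀ = normaliseAt zero X

  normalise-∝ : ∀ {n} {H : Hypergraph m n} (v : Fin n) (X : Stabiliser H) → Stab.d (normalise v X) ∝ d X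
  normalise-∝ {suc n} _ X = normaliseAt-∝ zero X

  ∝⇒≈D : ∀ {n} {H : Hypergraph m n} (X Y : Stab K H) → Stab.d X ∝ Stab.d Y → _≈D_ K X Y
  ∝⇒≈D {zero}  X Y _ ()
  ∝⇒≈D {suc n} X Y (a , _ , _ , dX≈dYa) i = begin
    Stab.d X i        ≈⟨ dX≈dYa i ⟩
    Stab.d Y i · a    ≈⟨ *-congˡ a≈1 ⟩
    Stab.d Y i · 1#   ≈⟨ *-identityʳ _ ⟩
    Stab.d Y i        ∎
    where
    a≈1 : a ≈ 1#
    a≈1 = begin
      a                   ≈⟨ *-identityˡ a ⟨
      1# · a              ≈⟨ *-congʳ (Stab.d₁ Y zero ≡.refl) ⟨
      Stab.d Y zero · a   ≈⟨ dX≈dYa zero ⟨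
      Stab.d X zero       ≈⟨ Stab.d₁ X zero ≡.refl ⟩
      1#                  ∎

  -- StabIndex K H k unfolds to Enumeration (stabSetoid H) k.
  stabSetoid : ∀ {n} → Hypergraph m n → Setoid (c ⊔ ℓ) ℓ
  stabSetoid {n} H = On.setoid {B = Stab K H} (VectorEquality.≋-setoid setoid n) Stab.d

  restrict : ∀ {n′ n} {H′ : Hypergraph m n′} {H : Hypergraph m n} (f : Fin n′ → Fin n) →
             (∀ s → s ∈ edges H′ → mapS f s ∈ edges H) → Stabiliser H → Stabiliser H′
  restrict {H = H} f f-edges X = record
    { d           = d X ∘ f
    ; e           = e X ∘ f
    ; d-inv       = d-inv X ∘ f
    ; stabilising = λ i js edge →
        stabilising X (f i) (f ∘ js)
          (≡.subst (_∈ edges H) (mapS-tupleSet f ≡.refl (λ _ → ≡.refl)) (f-edges _ edge))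
    }

  stabilising-image : ∀ {n′ n} {H′ : Hypergraph m n′} {f : Fin n′ → Fin n} → Injective f →
                      ∀ {D E : Fin n → Carrier} (X : Stabiliser H′) →
                      (∀ a → D (f a) ≈ d X a) → (∀ a → E (f a) ≈ e X a) →
                      ∀ i js s → s ∈ edges H′ → tupleSet K {m} i js ≡ mapS f s →
                      powK ring (E i) (m ∸ 1) · prodK ring (D ∘ js) ≈ 1#
  stabilising-image {H′ = H′} f-injective {D} X D∘f≈d E∘f≈e i js s s∈ ts≡fs
    with tupleSet-preimage f-injective {i} {js} ts≡fs
  ... | i′ , js′ , ≡.refl , fjs′≡js , ts′≡s =
    trans (*-cong (powK-congˡ (m ∸ 1) (E∘f≈e i′)) (prodK-cong D∘js≈d∘js′))
          (stabilising X i′ js′ (≡.subst (_∈ edges H′) (≡.sym ts′≡s) s∈))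
    where
    D∘js≈d∘js′ : ∀ k → D (js k) ≈ d X (js′ k)
    D∘js≈d∘js′ k = ≡.subst (λ v → D v ≈ d X (js′ k)) (fjs′≡js k) (D∘f≈d (js′ k))

  module Coalescence {n₁ n₂ n} {G₁ : Hypergraph m n₁} {G₂ : Hypergraph m n₂} {G : Hypergraph m n}
                     {u₁ : Fin n₁} {u₂ : Fin n₂} {f₁ : Fin n₁ → Fin n} {f₂ : Fin n₂ → Fin n}
                     (coalescence : IsCoalescence G₁ u₁ G₂ u₂ G f₁ f₂) where
    open IsCoalescence coalescence renaming (inj₁ to f₁-injective; inj₂ to f₂-injective; glue to f₁u₁≡f₂u₂)

    amalgamate : (Fin n₁ → Carrier) → (Fin n₂ → Carrier) → Fin n → Carrier
    amalgamate g₁ g₂ v = [ g₁ ∘ proj₁ , g₂ ∘ proj₁ ]′ (cover v)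

    amalgamate-f₁ : ∀ g₁ g₂ → g₁ u₁ ≈ g₂ u₂ → ∀ a → amalgamate g₁ g₂ (f₁ a) ≈ g₁ a
    amalgamate-f₁ _ _ g₁u₁≈g₂u₂ a with cover (f₁ a)
    ... | inj₁ (a′ , fa′≡fa) rewrite f₁-injective a′ a fa′≡fa = refl
    ... | inj₂ (b , fb≡fa) with onlyU a b (≡.sym fb≡fa)
    ...   | ≡.refl , ≡.refl = sym g₁u₁≈g₂u₂

    amalgamate-f₂ : ∀ g₁ g₂ → g₁ u₁ ≈ g₂ u₂ → ∀ b → amalgamate g₁ g₂ (f₂ b) ≈ g₂ b
    amalgamate-f₂ _ _ g₁u₁≈g₂u₂ b with cover (f₂ b)
    ... | inj₂ (b′ , fb′≡fb) rewrite f₂-injective b′ b fb′≡fb = refl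
    ... | inj₁ (a , fa≡fb) with onlyU a b fa≡fb
    ...   | ≡.refl , ≡.refl = g₁u₁≈g₂u₂

    amalgamate-inverse : ∀ {g₁ h₁ g₂ h₂} → (∀ a → g₁ a · h₁ a ≈ 1#) → (∀ b → g₂ b · h₂ b ≈ 1#) →
                         ∀ v → amalgamate g₁ g₂ v · amalgamate h₁ h₂ v ≈ 1#
    amalgamate-inverse g₁h₁≈1 g₂h₂≈1 v with cover v
    ... | inj₁ (a , _) = g₁h₁≈1 a
    ... | inj₂ (b , _) = g₂h₂≈1 b

    glue : (X₁ : Stabiliser G₁) (X₂ : Stabiliser G₂) → d X₁ u₁ ≈ d X₂ u₂ → e X₁ u₁ ≈ e X₂ u₂ → Stabiliser G
    glue X₁ X₂ d≈ e≈ = record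
      { d           = D
      ; e           = E
      ; d-inv       = amalgamate-inverse (d-inv X₁) (d-inv X₂)
      ; stabilising = stable
      }
      where
      D E : Fin n → Carrier
      D = amalgamate (d X₁) (d X₂)
      E = amalgamate (e X₁) (e X₂)
      stable : Stabilising G D E
      stable i js edge with Equivalence.to (edgesEq (tupleSet K {m} i js)) edge
      ... | inj₁ (s , s∈ , ts≡) = stabilising-image f₁-injective {D} {E} X₁
            (amalgamate-f₁ (d X₁) (d X₂) d≈) (amalgamate-f₁ (e X₁) (e X₂) e≈) i js s s∈ ts≡
      ... | inj₂ (s , s∈ , ts≡) = stabilising-image f₂-injective {D} {E} X₂
            (amalgamate-f₂ (d X₁) (d X₂) d≈) (amalgamate-f₂ (e X₁) (e X₂) e≈) i js s s∈ ts≡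

    -- The two scalars coincide at the shared vertex f₁ u₁ = f₂ u₂, where h is invertible.
    ∝-glue : ∀ {g h : Fin n → Carrier} {h′} → h (f₁ u₁) · h′ ≈ 1# →
             (g ∘ f₁) ∝ (h ∘ f₁) → (g ∘ f₂) ∝ (h ∘ f₂) → g ∝ h
    ∝-glue {g} {h} hu-unit (a , a′ , aa′≈1 , g≈ha) (b , _ , _ , g≈hb) =
      a , a′ , aa′≈1 , λ v → g≈ha-on v (cover v)
      where
      a≈b : a ≈ b
      a≈b = *-cancelʳ hu-unit (begin
        a · h (f₁ u₁)   ≈⟨ *-comm _ _ ⟩
        h (f₁ u₁) · a   ≈⟨ g≈ha u₁ ⟨
        g (f₁ u₁)       ≈⟨ ≡.subst (λ v → g v ≈ h v · b) (≡.sym f₁u₁≡f₂u₂) (g≈hb u₂) ⟩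
        h (f₁ u₁) · b   ≈⟨ *-comm _ _ ⟩
        b · h (f₁ u₁)   ∎)
      g≈ha-on : ∀ v → (∃[ a ] f₁ a ≡ v) ⊎ (∃[ b ] f₂ b ≡ v) → g v ≈ h v · a
      g≈ha-on _ (inj₁ (x , ≡.refl)) = g≈ha x
      g≈ha-on _ (inj₂ (y , ≡.refl)) = trans (g≈hb y) (*-congˡ (sym a≈b))

    d-agree : (S : Stab K G₁) (T : Stab K G₂) →
              d (normaliseAt u₁ (stabiliser S)) u₁ ≈ d (normaliseAt u₂ (stabiliser T)) u₂
    d-agree S T = trans (normaliseAt-d u₁ (stabiliser S)) (sym (normaliseAt-d u₂ (stabiliser T)))

    glued : Stab K G₁ → Stab K G₂ → Stabiliser G
    glued S T = glue (normaliseAt u₁ (stabiliser S)) (normaliseAt u₂ (stabiliser T)) (d-agree S T)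
      (trans (normaliseAt-e u₁ (stabiliser S)) (sym (normaliseAt-e u₂ (stabiliser T))))

    glued-f₁ : ∀ S T a → d (glued S T) (f₁ a) ≈ d (normaliseAt u₁ (stabiliser S)) a
    glued-f₁ S T = amalgamate-f₁ _ _ (d-agree S T)

    glued-f₂ : ∀ S T b → d (glued S T) (f₂ b) ≈ d (normaliseAt u₂ (stabiliser T)) b
    glued-f₂ S T = amalgamate-f₂ _ _ (d-agree S T)

    pair : Stab K G₁ → Stab K G₂ → Stab K G
    pair S T = normalise (f₁ u₁) (glued S T)

    restrict₁ : Stabiliser G → Stabiliser G₁
    restrict₁ = restrict f₁ λ s s∈ → Equivalence.from (edgesEq _) (inj₁ (s , s∈ , ≡.refl))

    restrict₂ : Stabiliser G → Stabiliser G₂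
    restrict₂ = restrict f₂ λ s s∈ → Equivalence.from (edgesEq _) (inj₂ (s , s∈ , ≡.refl))

    split₁ : Stab K G → Stab K G₁
    split₁ X = normalise u₁ (restrict₁ (stabiliser X))

    split₂ : Stab K G → Stab K G₂
    split₂ X = normalise u₂ (restrict₂ (stabiliser X))

    pair-∝₁ : ∀ S T → (Stab.d (pair S T) ∘ f₁) ∝ Stab.d S
    pair-∝₁ S T = ∝-trans (∝-∘ f₁ (normalise-∝ (f₁ u₁) (glued S T)))
                  (∝-trans (≈⇒∝ (glued-f₁ S T)) (normaliseAt-∝ u₁ (stabiliser S)))

    pair-∝₂ : ∀ S T → (Stab.d (pair S T) ∘ f₂) ∝ Stab.d T
    pair-∝₂ S T = ∝-trans (∝-∘ f₂ (normalise-∝ (f₁ u₁) (glued S T)))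
                  (∝-trans (≈⇒∝ (glued-f₂ S T)) (normaliseAt-∝ u₂ (stabiliser T)))

    pair-cong : ∀ S S′ T T′ → _≈D_ K S S′ → _≈D_ K T T′ → _≈D_ K (pair S T) (pair S′ T′)
    pair-cong S S′ T T′ S≈S′ T≈T′ = ∝⇒≈D (pair S T) (pair S′ T′) (∝-glue (Stab.d-inv (pair S′ T′) (f₁ u₁))
      (∝-trans (pair-∝₁ S T) (∝-trans (≈⇒∝ S≈S′) (∝-sym (pair-∝₁ S′ T′))))
      (∝-trans (pair-∝₂ S T) (∝-trans (≈⇒∝ T≈T′) (∝-sym (pair-∝₂ S′ T′)))))

    pair-injective : ∀ S S′ T T′ → _≈D_ K (pair S T) (pair S′ T′) → _≈D_ K S S′ × _≈D_ K T T′
    pair-injective S S′ T T′ pair≈ =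
      ∝⇒≈D S S′ (∝-trans (∝-sym (pair-∝₁ S T)) (∝-trans (≈⇒∝ (pair≈ ∘ f₁)) (pair-∝₁ S′ T′))) ,
      ∝⇒≈D T T′ (∝-trans (∝-sym (pair-∝₂ S T)) (∝-trans (≈⇒∝ (pair≈ ∘ f₂)) (pair-∝₂ S′ T′)))

    pair-split : ∀ X → _≈D_ K (pair (split₁ X) (split₂ X)) X
    pair-split X = ∝⇒≈D (pair (split₁ X) (split₂ X)) X (∝-glue (Stab.d-inv X (f₁ u₁))
      (∝-trans (pair-∝₁ (split₁ X) (split₂ X)) (normalise-∝ u₁ (restrict₁ (stabiliser X))))
      (∝-trans (pair-∝₂ (split₁ X) (split₂ X)) (normalise-∝ u₂ (restrict₂ (stabiliser X)))))

    pair-bijection : Bijection (stabSetoid G₁ ×ₛ stabSetoid G₂) (stabSetoid G)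
    pair-bijection = record
      { to        = uncurry pair
      ; cong      = λ {x} {y} → to-cong {x} {y}
      ; bijective = (λ {x} {y} → pair-injective (proj₁ x) (proj₁ y) (proj₂ x) (proj₂ y)) ,
                    strictlySurjective⇒surjective {f = uncurry pair} (λ {x} {y} → to-cong {x} {y})
                      (λ X → (split₁ X , split₂ X) , pair-split X)
      }
      where
      open FunctionConsequences (stabSetoid G₁ ×ₛ stabSetoid G₂) (stabSetoid G)
        using (strictlySurjective⇒surjective)
      to-cong : ∀ {x y} → _≈D_ K (proj₁ x) (proj₁ y) × _≈D_ K (proj₂ x) (proj₂ y) →
                _≈D_ K (uncurry pair x) (uncurry pair y)
      to-cong {x} {y} = uncurry (pair-cong (proj₁ x) (proj₁ y) (proj₂ x) (proj₂ y))

lemma3p1 : ∀ {c ℓ} (K : CharZeroField c ℓ) (m : ℕ) → 2 ≤ m →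
    ∀ {n₁ n₂ n} (G₁ : Hypergraph m n₁) (G₂ : Hypergraph m n₂) (G : Hypergraph m n)
    (u₁ : Fin n₁) (u₂ : Fin n₂) (f₁ : Fin n₁ → Fin n) (f₂ : Fin n₂ → Fin n) →
    2 ≤ n₁ → 2 ≤ n₂ → Connected G₁ → Connected G₂ →
    IsCoalescence G₁ u₁ G₂ u₂ G f₁ f₂ →
    ∀ k₁ k₂ → StabIndex K G₁ k₁ → StabIndex K G₂ k₂ → StabIndex K G (k₁ * k₂)
lemma3p1 K m _ _ _ _ _ _ _ _ _ _ _ _ coalescence _ _ enumeration₁ enumeration₂ =
  enumeration-× enumeration₁ enumeration₂ (Coalescence.pair-bijection K m coalescence)
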